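{- For a set $(X,=_X)$ let $\varepsilon X:=(X,=_{(X,\mathbb F(X))},\neq_{(X,\mathbb F(X))};\mathbb F(X))$ (a completely separated set). (i) The identity $i_X:(X,=_X)\to(X,=_{(X,\mathbb F(X))})$ is a function, and for every completely separated set $Y=(Y,=_Y,\neq_Y;G)$ and every function $h:(X,=_X)\to(Y,=_Y)$ there is a unique strongly extensional function $\varepsilon h:\varepsilon X\to Y$ with $\varepsilon h\circ i_X=h$. (ii) For every completely separated set $(X,=_X,\neq_X;F)$, the identity map is a surjective strongly extensional function from $\varepsilon X$ (the free completely separated set on $(X,=_X)$) onto $(X,=_X,\neq_X;F)$; thus every completely separated set is a quotient of the free completely separated set over it. (iii) Let $\mathrm{Free}:\mathbf{Set}\to\mathbf{SetComplSep}$ be given by $\mathrm{Free}(X,=_X):=\varepsilon X$ and, for $f:X\to Y$, $\mathrm{Free}(f):=\varepsilon(i_Y\circ f):\varepsilon X\to\varepsilon Y$, and let $\mathrm{Frg}:\mathbf{SetComplSep}\to\mathbf{Set}$ be the forgetful functor $\mathrm{Frg}(X,=_X,\neq_X;F):=(X,=_X)$, $\mathrm{Frg}(h):=h$. Then $\mathrm{Free}$ is left adjoint to $\mathrm{Frg}$.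
   Context: Constructive (Bishop-style) setting. A set $(X,=_X)$ has an equality; functions preserve equalities; $\mathbf{Set}$ is the category of sets and functions. $\mathbb F(X)$ is the set of functions $X\to\mathbb R$ with pointwise equality; $a\neq_{\mathbb R}b$ iff $|a-b|>0$. For an extensional subset $F\subseteq\mathbb F(X)$ (given by an equality-stable property): $x=_{(X,F)}x'$ iff $\forall f\in F\,f(x)=_{\mathbb R}f(x')$; $x\neq_{(X,F)}x'$ iff $\exists f\in F\,f(x)\neq_{\mathbb R}f(x')$. A set with an inequality is $(X,=_X,\neq_X)$ where $x=_Xy$ and $x\neq_Xy$ are contradictory; a function between sets with inequality is strongly extensional if $f(x)\neq f(y)\Rightarrow x\neq y$. A completely separated set is $(X,=_X,\neq_X;F)$ with $F$ an extensional subset of $\mathbb F(X)$, $\neq_X$ equivalent to $\neq_{(X,F)}$, and $x=_{(X,F)}x'\Rightarrow x=_Xx'$. $\mathbf{SetComplSep}$ is the category of completely separated sets with strongly extensional functions as arrows. -}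

module Defs where

open import Level using (0ℓ)
open import Data.Nat using (ℕ; suc) renaming (_+_ to _+ℕ_)
open import Data.Integer using (+_)
open import Data.Rational using (ℚ; _/_; _-_; ∣_∣; _≤_; _<_; _+_)
open import Data.Product using (Σ; _×_; _,_)
open import Data.Unit using (⊤)
open import Data.Empty using (⊥)
open import Relation.Binary using (Rel; Setoid; IsEquivalence)
open import Relation.Binary.PropositionalEquality using (_≡_)
open import Function.Bundles using (Func)
import Function.Construct.Composition as Comp
import Function.Construct.Identity as Ident

-- Bishop's real numbers (regular sequences of rationals).
-- We index from 0: `seq x n` is Bishop's x_{n+1}.

1/[_] : ℕ → ℚ
1/[ n ] = + 1 / suc n

record ℝ : Set where
  constructor mkℝ
  field
    seq     : ℕ → ℚ
    regular : ∀ m n → ∣ seq m - seq n ∣ ≤ 1/[ m ] + 1/[ n ]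
open ℝ public

_=ℝ_ : ℝ → ℝ → Set
x =ℝ y = ∀ n → ∣ seq x n - seq y n ∣ ≤ + 2 / suc n

-- a ≠ b  iff  |a - b| > 0, unfolded with Bishop's definitions:
-- (x - y)_n = x_{2n} - y_{2n},  |z|_n = |z_n|,  z > 0 iff ∃ n ≥ 1, z_n > 1/n.
-- With n = k+1, Bishop's x_{2n} is `seq x (suc (k + k))`.
_≠ℝ_ : ℝ → ℝ → Set
x ≠ℝ y = Σ ℕ λ k → 1/[ k ] < ∣ seq x (suc (k +ℕ k)) - seq y (suc (k +ℕ k)) ∣

record 𝔽 (A : Set) (_≈_ : Rel A 0ℓ) : Set where
  field
    ap  : A → ℝ
    ext : ∀ {x y} → x ≈ y → ap x =ℝ ap y
open 𝔽 public

IsExtensionalSubset : {A : Set} {_≈_ : Rel A 0ℓ} → (𝔽 A _≈_ → Set) → Set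
IsExtensionalSubset {A} F = ∀ f g → (∀ (x : A) → ap f x =ℝ ap g x) → F f → F g

module _ {A : Set} {_≈_ : Rel A 0ℓ} (F : 𝔽 A _≈_ → Set) where

  EqF : Rel A 0ℓ
  EqF x y = ∀ (f : 𝔽 A _≈_) → F f → ap f x =ℝ ap f y

  NeqF : Rel A 0ℓ
  NeqF x y = Σ (𝔽 A _≈_) λ f → F f × (ap f x ≠ℝ ap f y)

record IsCompletelySeparated (A : Set) (_≈_ _≠_ : Rel A 0ℓ)
                             (F : 𝔽 A _≈_ → Set) : Set where
  field
    isEquivalence : IsEquivalence _≈_
    ≈-≠-contra    : ∀ {x y} → x ≈ y → x ≠ y → ⊥
    F-extensional : IsExtensionalSubset F
    ≠⇒≠F          : ∀ {x y} → x ≠ y → NeqF F x y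
    ≠F⇒≠          : ∀ {x y} → NeqF F x y → x ≠ y
    =F⇒=          : ∀ {x y} → EqF F x y → x ≈ y

record CSSet : Set₁ where
  field
    Carrier : Set
    _≈_     : Rel Carrier 0ℓ
    _≠_     : Rel Carrier 0ℓ
    F       : 𝔽 Carrier _≈_ → Set
    isCS    : IsCompletelySeparated Carrier _≈_ _≠_ F

  setoid : Setoid 0ℓ 0ℓ
  setoid = record
    { Carrier       = Carrier
    ; _≈_           = _≈_
    ; isEquivalence = IsCompletelySeparated.isEquivalence isCS
    }

record SEHom (X Y : CSSet) : Set where
  private
    module X = CSSet X
    module Y = CSSet Y
  field
    fn        : X.Carrier → Y.Carrier
    cong      : ∀ {x x'} → x X.≈ x' → fn x Y.≈ fn x'
    strongExt : ∀ {x x'} → fn x Y.≠ fn x' → x X.≠ x'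
open SEHom public

idS : (X : CSSet) → SEHom X X
idS X = record { fn = λ x → x ; cong = λ p → p ; strongExt = λ p → p }

_∘S_ : {X Y Z : CSSet} → SEHom Y Z → SEHom X Y → SEHom X Z
g ∘S f = record
  { fn        = λ x → fn g (fn f x)
  ; cong      = λ p → cong g (cong f p)
  ; strongExt = λ p → strongExt f (strongExt g p)
  }

_≈S_ : {X Y : CSSet} → SEHom X Y → SEHom X Y → Set
_≈S_ {X} {Y} f g = ∀ (x : CSSet.Carrier X) → CSSet._≈_ Y (fn f x) (fn g x)

_∘F_ : {X Y Z : Setoid 0ℓ 0ℓ} → Func Y Z → Func X Y → Func X Z
g ∘F f = Comp.function f g

idF : (X : Setoid 0ℓ 0ℓ) → Func X X
idF X = Ident.function X

_≈F_ : {X Y : Setoid 0ℓ 0ℓ} → Func X Y → Func X Y → Set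
_≈F_ {X} {Y} f g = ∀ (x : Setoid.Carrier X) → Setoid._≈_ Y (Func.to f x) (Func.to g x)

Frg₀ : CSSet → Setoid 0ℓ 0ℓ
Frg₀ Y = CSSet.setoid Y

Frg₁ : {X Y : CSSet} → SEHom X Y → Func (Frg₀ X) (Frg₀ Y)
Frg₁ h = record { to = fn h ; cong = cong h }

module _ (X : Setoid 0ℓ 0ℓ) where
  private
    A = Setoid.Carrier X

  _≈ε_ : Rel A 0ℓ
  _≈ε_ = EqF {A} {Setoid._≈_ X} (λ _ → ⊤)

  _≠ε_ : Rel A 0ℓ
  _≠ε_ = NeqF {A} {Setoid._≈_ X} (λ _ → ⊤)

  -- the claim "εX is a completely separated set" (with F = 𝔽 of εX, i.e. all
  -- real-valued functions; these are exactly the elements of 𝔽(X))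
  IsεCS : Set
  IsεCS = IsCompletelySeparated A _≈ε_ _≠ε_ (λ _ → ⊤)

ε : (X : Setoid 0ℓ 0ℓ) → IsεCS X → CSSet
ε X p = record
  { Carrier = Setoid.Carrier X
  ; _≈_     = _≈ε_ X
  ; _≠_     = _≠ε_ X
  ; F       = λ _ → ⊤
  ; isCS    = p
  }

-- The three parts of the theorem, relative to a proof `isε` that every εX
-- is a completely separated set.

module _ (isε : (X : Setoid 0ℓ 0ℓ) → IsεCS X) where

  εX : Setoid 0ℓ 0ℓ → CSSet
  εX X = ε X (isε X)

  i : (X : Setoid 0ℓ 0ℓ) → Func X (Frg₀ (εX X))
  i X = record { to = λ x → x ; cong = λ p f _ → ext f p }

  PartI : Set₁
  PartI = (X : Setoid 0ℓ 0ℓ) →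
      (∀ {x x'} → Setoid._≈_ X x x' → _≈ε_ X x x')
    × ((Y : CSSet) (h : Func X (Frg₀ Y)) →
        Σ (SEHom (εX X) Y) λ εh →
            ((Frg₁ εh ∘F i X) ≈F h)
          × ((k : SEHom (εX X) Y) → (Frg₁ k ∘F i X) ≈F h → k ≈S εh))

  PartII : Set₁
  PartII = (X : CSSet) →
    Σ (SEHom (εX (Frg₀ X)) X) λ u →
        (∀ x → fn u x ≡ x)
      × (∀ (y : CSSet.Carrier X) → Σ (CSSet.Carrier X) λ x → CSSet._≈_ X (fn u x) y)

  FreeArrows : Set₁
  FreeArrows = ∀ {X Y : Setoid 0ℓ 0ℓ} → Func X Y → SEHom (εX X) (εX Y)

  -- Free₁ f is specified as ε(i_Y ∘ f), i.e. by Free₁ f ∘ i_X = i_Y ∘ f.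
  FreeArrowSpec : FreeArrows → Set₁
  FreeArrowSpec Free₁ =
    ∀ {X Y : Setoid 0ℓ 0ℓ} (f : Func X Y) → (Frg₁ (Free₁ f) ∘F i X) ≈F (i Y ∘F f)

  record IsFunctorFree (Free₁ : FreeArrows) : Set₁ where
    field
      F-resp : ∀ {X Y : Setoid 0ℓ 0ℓ} {f g : Func X Y} → f ≈F g → Free₁ f ≈S Free₁ g
      F-id   : ∀ {X : Setoid 0ℓ 0ℓ} → Free₁ (idF X) ≈S idS (εX X)
      F-comp : ∀ {X Y Z : Setoid 0ℓ 0ℓ} (f : Func X Y) (g : Func Y Z) →
               Free₁ (g ∘F f) ≈S (Free₁ g ∘S Free₁ f)

  record FreeLeftAdjoint (Free₁ : FreeArrows) : Set₁ where
    field
      φ       : ∀ {X : Setoid 0ℓ 0ℓ} {Y : CSSet} → SEHom (εX X) Y → Func X (Frg₀ Y)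
      ψ       : ∀ {X : Setoid 0ℓ 0ℓ} {Y : CSSet} → Func X (Frg₀ Y) → SEHom (εX X) Y
      φ-resp  : ∀ {X : Setoid 0ℓ 0ℓ} {Y : CSSet} {k k' : SEHom (εX X) Y} → k ≈S k' → φ k ≈F φ k'
      ψ-resp  : ∀ {X : Setoid 0ℓ 0ℓ} {Y : CSSet} {h h' : Func X (Frg₀ Y)} → h ≈F h' → ψ {X} {Y} h ≈S ψ {X} {Y} h'
      φψ      : ∀ {X : Setoid 0ℓ 0ℓ} {Y : CSSet} (h : Func X (Frg₀ Y)) → φ (ψ {X} {Y} h) ≈F h
      ψφ      : ∀ {X : Setoid 0ℓ 0ℓ} {Y : CSSet} (k : SEHom (εX X) Y) → ψ (φ k) ≈S k
      natural : ∀ {X' X : Setoid 0ℓ 0ℓ} {Y Y' : CSSet} (f : Func X' X) (g : SEHom Y Y') (k : SEHom (εX X) Y) →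
                φ (g ∘S (k ∘S Free₁ f)) ≈F (Frg₁ g ∘F (φ k ∘F f))

  PartIII : Set₁
  PartIII = (Free₁ : FreeArrows) →
            FreeArrowSpec Free₁ → IsFunctorFree Free₁ × FreeLeftAdjoint Free₁

-- Equality and apartness in εX are tested against all of 𝔽(X); Bishop
-- equality of reals is an equivalence excluding apartness, so εX is completely
-- separated.  For a function h from X into a completely separated set (Y, G),
-- every g ∈ G pulls back to g ∘ h ∈ 𝔽(X).  Hence h sends 𝔽(X)-equal points to
-- G-equal, hence equal, points, and G-apart images have 𝔽(X)-apart preimages:
-- h itself is the strongly extensional εh.  For h the identity this is the
-- quotient map of (ii), and h ↦ εh inverts precomposition with i_X, which is
-- the adjunction of (iii).
module Submission where

open import Defs
open import Level using (0ℓ)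
open import Data.Product using (Σ; _×_; _,_)
open import Data.Unit using (tt)
open import Function.Bundles using (Func)
open import Relation.Binary using (Rel; Setoid; IsEquivalence; Reflexive; Symmetric; Transitive)
open import Relation.Binary.PropositionalEquality as ≡
  using (_≡_; refl; sym; subst; module ≡-Reasoning)
open import Relation.Nullary using (¬_; contradiction)
import Relation.Binary.Reasoning.Setoid as SetoidReasoning

open import Data.Nat as ℕ using (ℕ; suc)
import Data.Nat.Properties as ℕ
open import Data.Nat.Tactic.RingSolver using (solve-∀)
open import Data.Nat.Coprimality using (1-coprimeTo)
open import Data.Integer as ℤ using (+_; +[1+_]; -[1+_])
import Data.Integer.Properties as ℤ
import Data.Integer.Tactic.RingSolver as ℤ-Solver
open import Data.Rational using (ℚ; mkℚ; _/_; _-_; -_; ∣_∣; _≤_; _+_; 0ℚ; toℚᵘ; *≤*)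
open import Data.Rational.Properties
import Data.Rational.Unnormalised as ℚᵘ
import Data.Rational.Unnormalised.Properties as ℚᵘ
open import Data.Rational.Solver using (module +-*-Solver)

_/[_] : ℕ → ℕ → ℚ
a /[ m ] = + a / suc m

mkℚᵘ-+-sameDenominator : ∀ i j m → ℚᵘ.mkℚᵘ i m ℚᵘ.+ ℚᵘ.mkℚᵘ j m ℚᵘ.≃ ℚᵘ.mkℚᵘ (i ℤ.+ j) m
mkℚᵘ-+-sameDenominator i j m = ℚᵘ.*≡* (identity i j (+ suc m))
  where
  identity : ∀ i j d → (i ℤ.* d ℤ.+ j ℤ.* d) ℤ.* d ≡ (i ℤ.+ j) ℤ.* (d ℤ.* d)
  identity = ℤ-Solver.solve-∀

/[]-+ : ∀ a b m → a /[ m ] + b /[ m ] ≡ (a ℕ.+ b) /[ m ]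
/[]-+ a b m = toℚᵘ-injective (begin-equality
  toℚᵘ (a /[ m ] + b /[ m ])            ≃⟨ toℚᵘ-homo-+ (a /[ m ]) (b /[ m ]) ⟩
  toℚᵘ (a /[ m ]) ℚᵘ.+ toℚᵘ (b /[ m ])  ≃⟨ ℚᵘ.+-cong (toℚᵘ-fromℚᵘ (ℚᵘ.mkℚᵘ (+ a) m))
                                                      (toℚᵘ-fromℚᵘ (ℚᵘ.mkℚᵘ (+ b) m)) ⟩
  ℚᵘ.mkℚᵘ (+ a) m ℚᵘ.+ ℚᵘ.mkℚᵘ (+ b) m  ≃⟨ mkℚᵘ-+-sameDenominator (+ a) (+ b) m ⟩
  ℚᵘ.mkℚᵘ (+ (a ℕ.+ b)) m              ≃⟨ toℚᵘ-fromℚᵘ (ℚᵘ.mkℚᵘ (+ (a ℕ.+ b)) m) ⟨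
  toℚᵘ ((a ℕ.+ b) /[ m ])               ∎)
  where open ℚᵘ.≤-Reasoning

/[]-cross : ∀ {a b m n} → a ℕ.* suc n ≡ b ℕ.* suc m → a /[ m ] ≡ b /[ n ]
/[]-cross {a} {b} {m} {n} eq = fromℚᵘ-cong {ℚᵘ.mkℚᵘ (+ a) m} {ℚᵘ.mkℚᵘ (+ b) n} (ℚᵘ.*≡* (begin
  + a ℤ.* + suc n  ≡⟨ ℤ.pos-* a (suc n) ⟨
  + (a ℕ.* suc n)  ≡⟨ ≡.cong +_ eq ⟩
  + (b ℕ.* suc m)  ≡⟨ ℤ.pos-* b (suc m) ⟩
  + b ℤ.* + suc m  ∎))
  where open ≡-Reasoning

/[]-cancel : ∀ k n → suc k /[ k ℕ.+ n ℕ.* suc k ] ≡ 1/[ n ]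
/[]-cancel k n = /[]-cross {suc k} {1} {k ℕ.+ n ℕ.* suc k} {n} (identity k n)
  where
  identity : ∀ k n → suc k ℕ.* suc n ≡ 1 ℕ.* suc (k ℕ.+ n ℕ.* suc k)
  identity = solve-∀

p≤1/[n]⇒p≤0 : ∀ {p} → (∀ n → p ≤ 1/[ n ]) → p ≤ 0ℚ
p≤1/[n]⇒p≤0 {mkℚ (+ 0)    _ _} _ = *≤* (ℤ.+≤+ ℕ.z≤n)
p≤1/[n]⇒p≤0 {mkℚ -[1+ _ ] _ _} _ = *≤* ℤ.-≤+
-- A positive p = (k+1)/(d+1) already exceeds 1/(d+2).
p≤1/[n]⇒p≤0 {p@(mkℚ +[1+ k ] d _)} p≤1/[n]
  with subst (p ≤_) (normalize-coprime (1-coprimeTo (suc (suc d)))) (p≤1/[n] (suc d))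
... | *≤* k+1*d+2≤d+1 = contradiction d+2≤d+1 ℕ.1+n≰n
  where
  d+2≤d+1 : suc (suc d) ℕ.≤ suc d
  d+2≤d+1 = ℕ.≤-trans (ℕ.m≤n*m (suc (suc d)) (suc k))
             (ℕ.≤-trans (ℤ.drop‿+≤+ k+1*d+2≤d+1) (ℕ.≤-reflexive (ℕ.*-identityˡ (suc d))))

p≤q+1/[n]⇒p≤q : ∀ {p q} → (∀ n → p ≤ q + 1/[ n ]) → p ≤ q
p≤q+1/[n]⇒p≤q {p} {q} p≤q+1/[n] = begin
  p            ≡⟨ solve 2 (λ p q → p := (p :- q) :+ q) refl p q ⟩
  (p - q) + q  ≤⟨ +-monoˡ-≤ q (p≤1/[n]⇒p≤0 p-q≤1/[n]) ⟩
  0ℚ + q       ≡⟨ +-identityˡ q ⟩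
  q            ∎
  where
  open ≤-Reasoning
  open +-*-Solver
  p-q≤1/[n] : ∀ n → p - q ≤ 1/[ n ]
  p-q≤1/[n] n = begin
    p - q                ≤⟨ +-monoˡ-≤ (- q) (p≤q+1/[n] n) ⟩
    q + 1/[ n ] - q      ≡⟨ solve 2 (λ q r → q :+ r :- q := r) refl q (1/[ n ]) ⟩
    1/[ n ]              ∎

∣p-r∣≤∣p-q∣+∣q-r∣ : ∀ p q r → ∣ p - r ∣ ≤ ∣ p - q ∣ + ∣ q - r ∣
∣p-r∣≤∣p-q∣+∣q-r∣ p q r =
  subst (λ s → ∣ s ∣ ≤ ∣ p - q ∣ + ∣ q - r ∣)
        (solve 3 (λ p q r → (p :- q) :+ (q :- r) := p :- r) refl p q r)
        (∣p+q∣≤∣p∣+∣q∣ (p - q) (q - r))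
  where open +-*-Solver

=ℝ-refl : Reflexive _=ℝ_
=ℝ-refl {x} n = subst (_≤ 2 /[ n ]) (≡.cong ∣_∣ (sym (+-inverseʳ (seq x n))))
                      (nonNegative⁻¹ (2 /[ n ]) {{normalize-nonNeg 2 (suc n)}})

=ℝ-sym : Symmetric _=ℝ_
=ℝ-sym {x} {y} x=y n = subst (_≤ 2 /[ n ]) (∣p-q∣≡∣q-p∣ (seq x n) (seq y n)) (x=y n)
  where
  ∣p-q∣≡∣q-p∣ : ∀ p q → ∣ p - q ∣ ≡ ∣ q - p ∣
  ∣p-q∣≡∣q-p∣ p q = ≡.trans (≡.cong ∣_∣ (solve 2 (λ p q → p :- q := :- (q :- p)) refl p q))
                            (∣-p∣≡∣p∣ (q - p))
    where open +-*-Solver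

-- Going through x_m, y_m, z_m gives |x_n - z_n| ≤ 2/n + 6/m for every m;
-- m = 6k + 5 turns 6/m into 1/(k+1).
=ℝ-trans : Transitive _=ℝ_
=ℝ-trans {x} {y} {z} x=y y=z n = p≤q+1/[n]⇒p≤q λ k → begin
  ∣ seq x n - seq z n ∣               ≤⟨ bound (5 ℕ.+ k ℕ.* 6) ⟩
  2 /[ n ] + 6 /[ 5 ℕ.+ k ℕ.* 6 ]     ≡⟨ ≡.cong (2 /[ n ] +_) (/[]-cancel 5 k) ⟩
  2 /[ n ] + 1/[ k ]                  ∎
  where
  open ≤-Reasoning
  bound : ∀ m → ∣ seq x n - seq z n ∣ ≤ 2 /[ n ] + 6 /[ m ]
  bound m = begin
    ∣ xn - zn ∣                                          ≤⟨ ∣p-r∣≤∣p-q∣+∣q-r∣ xn xm zn ⟩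
    ∣ xn - xm ∣ + ∣ xm - zn ∣                            ≤⟨ +-monoʳ-≤ ∣ xn - xm ∣ (∣p-r∣≤∣p-q∣+∣q-r∣ xm ym zn) ⟩
    ∣ xn - xm ∣ + (∣ xm - ym ∣ + ∣ ym - zn ∣)            ≤⟨ +-monoʳ-≤ ∣ xn - xm ∣ (+-monoʳ-≤ ∣ xm - ym ∣
                                                              (∣p-r∣≤∣p-q∣+∣q-r∣ ym zm zn)) ⟩
    ∣ xn - xm ∣ + (∣ xm - ym ∣ + (∣ ym - zm ∣ + ∣ zm - zn ∣))
      ≤⟨ +-mono-≤ (regular x n m) (+-mono-≤ (x=y m) (+-mono-≤ (y=z m) (regular z m n))) ⟩
    (1/[ n ] + 1/[ m ]) + (2 /[ m ] + (2 /[ m ] + (1/[ m ] + 1/[ n ])))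
      ≡⟨ solve 3 (λ v u w → (v :+ u) :+ (w :+ (w :+ (u :+ v))) := (v :+ v) :+ (u :+ w :+ w :+ u))
               refl (1/[ n ]) (1/[ m ]) (2 /[ m ]) ⟩
    (1/[ n ] + 1/[ n ]) + (1/[ m ] + 2 /[ m ] + 2 /[ m ] + 1/[ m ])
      ≡⟨ ≡.cong₂ _+_ (/[]-+ 1 1 n) 1+2+2+1≡6 ⟩
    2 /[ n ] + 6 /[ m ]                                  ∎
    where
    open +-*-Solver
    xn = seq x n ; zn = seq z n ; xm = seq x m ; ym = seq y m ; zm = seq z m
    1+2+2+1≡6 : 1/[ m ] + 2 /[ m ] + 2 /[ m ] + 1/[ m ] ≡ 6 /[ m ]
    1+2+2+1≡6 rewrite /[]-+ 1 2 m | /[]-+ 3 2 m = /[]-+ 5 1 m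

=ℝ⇒¬≠ℝ : ∀ {x y} → x =ℝ y → ¬ (x ≠ℝ y)
=ℝ⇒¬≠ℝ {x} {y} x=y (k , 1/[k]<d) =
  <-irrefl refl (<-≤-trans 1/[k]<d (subst (d ≤_) 2/[2k+1]≡1/[k] (x=y (suc (k ℕ.+ k)))))
  where
  d = ∣ seq x (suc (k ℕ.+ k)) - seq y (suc (k ℕ.+ k)) ∣
  identity : ∀ k → 2 ℕ.* suc k ≡ 1 ℕ.* suc (suc (k ℕ.+ k))
  identity = solve-∀
  2/[2k+1]≡1/[k] : 2 /[ suc (k ℕ.+ k) ] ≡ 1/[ k ]
  2/[2k+1]≡1/[k] = /[]-cross {2} {1} {suc (k ℕ.+ k)} {k} (identity k)

module _ {A : Set} {_≈_ : Rel A 0ℓ} (F : 𝔽 A _≈_ → Set) where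

  EqF-isEquivalence : IsEquivalence (EqF F)
  EqF-isEquivalence = record
    { refl  = λ {x} f _ → =ℝ-refl {ap f x}
    ; sym   = λ {x} {y} x=y f f∈F → =ℝ-sym {ap f x} {ap f y} (x=y f f∈F)
    ; trans = λ {x} {y} {z} x=y y=z f f∈F →
                =ℝ-trans {ap f x} {ap f y} {ap f z} (x=y f f∈F) (y=z f f∈F)
    }

  EqF⇒¬NeqF : ∀ {x y} → EqF F x y → ¬ NeqF F x y
  EqF⇒¬NeqF {x} {y} x=y (f , f∈F , fx≠fy) = =ℝ⇒¬≠ℝ {ap f x} {ap f y} (x=y f f∈F) fx≠fy

𝔽-precompose : ∀ {A B} {_≈ᴬ_ : Rel A 0ℓ} {_≈ᴮ_ : Rel B 0ℓ} (h : A → B) →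
               (∀ {x y} → x ≈ᴬ y → h x ≈ᴮ h y) → 𝔽 B _≈ᴮ_ → 𝔽 A _≈ᴬ_
𝔽-precompose h h-cong g = record { ap = λ x → ap g (h x) ; ext = λ x≈y → ext g (h-cong x≈y) }

module _ (X : Setoid 0ℓ 0ℓ) where
  open Setoid X

  ≈⇒≈ε : ∀ {x y} → x ≈ y → _≈ε_ X x y
  ≈⇒≈ε x≈y f _ = ext f x≈y

  𝔽-respects-≈ε : 𝔽 Carrier _≈_ → 𝔽 Carrier (_≈ε_ X)
  𝔽-respects-≈ε f = record { ap = ap f ; ext = λ x=y → x=y f tt }

  ε-isCompletelySeparated : IsεCS X
  ε-isCompletelySeparated = record
    { isEquivalence = EqF-isEquivalence _
    ; ≈-≠-contra    = EqF⇒¬NeqF _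
    ; F-extensional = λ _ _ _ _ → tt
    ; ≠⇒≠F          = λ { (f , _ , fx≠fy) → 𝔽-respects-≈ε f , tt , fx≠fy }
    ; ≠F⇒≠          = λ { (g , _ , gx≠gy) → 𝔽-precompose (λ x → x) ≈⇒≈ε g , tt , gx≠gy }
    ; =F⇒=          = λ x=y f _ → x=y (𝔽-respects-≈ε f) tt
    }

ε-lift : ∀ {X : Setoid 0ℓ 0ℓ} {Y : CSSet} → Func X (Frg₀ Y) → SEHom (εX ε-isCompletelySeparated X) Y
ε-lift {X} {Y} h = record
  { fn        = Func.to h
  ; cong      = λ x=x' → Y.=F⇒= (λ g _ → x=x' (pullback g) tt)
  ; strongExt = λ hx≠hx' → pullback-≠ (Y.≠⇒≠F hx≠hx')
  }
  where
  module Y = IsCompletelySeparated (CSSet.isCS Y)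
  pullback : 𝔽 (CSSet.Carrier Y) (CSSet._≈_ Y) → 𝔽 (Setoid.Carrier X) (Setoid._≈_ X)
  pullback = 𝔽-precompose (Func.to h) (Func.cong h)
  pullback-≠ : ∀ {x x'} → NeqF (CSSet.F Y) (Func.to h x) (Func.to h x') → _≠ε_ X x x'
  pullback-≠ (g , _ , gx≠gx') = pullback g , tt , gx≠gx'

εX-universal : PartI ε-isCompletelySeparated
εX-universal X = ≈⇒≈ε X , λ Y h → ε-lift h , (λ _ → Setoid.refl (Frg₀ Y)) , λ _ k∘i≈h → k∘i≈h

εX-quotient : PartII ε-isCompletelySeparated
εX-quotient X = ε-lift (idF (Frg₀ X)) , (λ _ → refl) , λ y → y , Setoid.refl (Frg₀ X)

module _ {Free₁ : FreeArrows ε-isCompletelySeparated}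
         (Free₁-spec : FreeArrowSpec ε-isCompletelySeparated Free₁) where

  private
    Free₀ = εX ε-isCompletelySeparated

  Free-resp : ∀ {X Y : Setoid 0ℓ 0ℓ} {f g : Func X Y} → f ≈F g → Free₁ f ≈S Free₁ g
  Free-resp {Y = Y} {f} {g} f≈g x = begin
    fn (Free₁ f) x  ≈⟨ Free₁-spec f x ⟩
    Func.to f x     ≈⟨ ≈⇒≈ε Y (f≈g x) ⟩
    Func.to g x     ≈⟨ Free₁-spec g x ⟨
    fn (Free₁ g) x  ∎
    where open SetoidReasoning (Frg₀ (Free₀ Y))

  Free-comp : ∀ {X Y Z : Setoid 0ℓ 0ℓ} (f : Func X Y) (g : Func Y Z) →
              Free₁ (g ∘F f) ≈S (Free₁ g ∘S Free₁ f)
  Free-comp {Z = Z} f g x = begin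
    fn (Free₁ (g ∘F f)) x           ≈⟨ Free₁-spec (g ∘F f) x ⟩
    Func.to g (Func.to f x)         ≈⟨ Free₁-spec g (Func.to f x) ⟨
    fn (Free₁ g) (Func.to f x)      ≈⟨ cong (Free₁ g) (Free₁-spec f x) ⟨
    fn (Free₁ g) (fn (Free₁ f) x)   ∎
    where open SetoidReasoning (Frg₀ (Free₀ Z))

  Free-isFunctor : IsFunctorFree ε-isCompletelySeparated Free₁
  Free-isFunctor = record
    { F-resp = Free-resp
    ; F-id   = λ {X} → Free₁-spec (idF X)
    ; F-comp = Free-comp
    }

  Free⊣Frg : FreeLeftAdjoint ε-isCompletelySeparated Free₁
  Free⊣Frg = record
    { φ       = λ {X} k → Frg₁ k ∘F i ε-isCompletelySeparated X
    ; ψ       = ε-lift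
    ; φ-resp  = λ k≈k' → k≈k'
    ; ψ-resp  = λ h≈h' → h≈h'
    ; φψ      = λ {Y = Y} _ _ → Setoid.refl (Frg₀ Y)
    ; ψφ      = λ {Y = Y} _ _ → Setoid.refl (Frg₀ Y)
    ; natural = λ f g k x → cong g (cong k (Free₁-spec f x))
    }

theorem5p2 : Σ ((X : Setoid 0ℓ 0ℓ) → IsεCS X) λ isε →
               PartI isε × PartII isε × PartIII isε
theorem5p2 = ε-isCompletelySeparated
           , εX-universal
           , εX-quotient
           , λ _ Free₁-spec → Free-isFunctor Free₁-spec , Free⊣Frg Free₁-spec
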